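{- Let $\{f_n\}_{n\ge1}$ and $\{g_n\}_{n\ge1}$ be sequences of complex numbers and set $g_0=-1$. Then for every $n\ge1$, \[ \sum_{\pi\in\mathcal{C}(n)} f_{|\pi|}\,g_\pi=\sum_{p=1}^{n} f_p\sum_{\substack{k_1+\dots+k_p=n\\ k_i\ge1}} g_{k_1}\cdots g_{k_p}=\sum_{p=1}^{n}\Bigl(\sum_{m=p}^{n} f_m\binom{m}{p}\Bigr)\sum_{\substack{k_1+\dots+k_p=n\\ k_i\ge0}} g_{k_1}\cdots g_{k_p}. \]
   Context: A composition of $n\ge1$ is a sequence $\pi=(n_1,\dots,n_m)$ of integers $n_i\ge1$ with $n_1+\dots+n_m=n$; $\mathcal{C}(n)$ is the set of compositions of $n$, $|\pi|=m$ is the number of parts, and $g_\pi=g_{n_1}\cdots g_{n_m}$. -}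

module Defs where

open import Level using (Level)
open import Data.Nat using (ℕ; zero; suc; _∸_)
import Data.Nat as ℕ
open import Data.Nat.Combinatorics using (_C_)
open import Data.List using (List; []; _∷_; [_]; map; concatMap; foldr; applyUpTo; length; upTo)
open import Algebra.Bundles using (CommutativeRing)
import Algebra.Definitions.RawMonoid as RawMonoidDefs

-- ℕ-range [a .. b] (inclusive); empty if b < a.
range : ℕ → ℕ → List ℕ
range a b = applyUpTo (a ℕ.+_) (suc b ∸ a)

-- All compositions of n: lists of positive integers (in order) summing to n.
-- compsF is a fuel-indexed enumeration: the first part is (suc k) for
-- k = 0..n-1, followed by a composition of the remainder.
compsF : ℕ → ℕ → List (List ℕ)
compsF _       zero    = [ [] ]
compsF zero    (suc n) = []
compsF (suc f) (suc n) =
  concatMap (λ k → map (suc k ∷_) (compsF f (n ∸ k))) (upTo (suc n))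

compositions : ℕ → List (List ℕ)
compositions n = compsF n n

posTuples : ℕ → ℕ → List (List ℕ)
posTuples zero    zero    = [ [] ]
posTuples zero    (suc n) = []
posTuples (suc p) n =
  concatMap (λ k → map (k ∷_) (posTuples p (n ∸ k))) (range 1 n)

natTuples : ℕ → ℕ → List (List ℕ)
natTuples zero    zero    = [ [] ]
natTuples zero    (suc n) = []
natTuples (suc p) n =
  concatMap (λ k → map (k ∷_) (natTuples p (n ∸ k))) (range 0 n)

module InRing {c ℓ : Level} (R : CommutativeRing c ℓ) where
  open CommutativeRing R

  Σ : {A : Set} → List A → (A → Carrier) → Carrier
  Σ xs h = foldr (λ x acc → h x + acc) 0# xs

  Π : {A : Set} → List A → (A → Carrier) → Carrier
  Π xs h = foldr (λ x acc → h x * acc) 1# xs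

  open RawMonoidDefs +-rawMonoid public using (_×_)

  withG₀ : (ℕ → Carrier) → ℕ → Carrier
  withG₀ g zero    = - 1#
  withG₀ g (suc k) = g (suc k)

  gProd : (ℕ → Carrier) → List ℕ → Carrier
  gProd g π = Π π g

-- Splitting a composition by its number of parts gives the first identity.
-- For the second, write P p n and N p n for the sums of g-products over
-- positive and non-negative p-tuples summing to n (with g₀ = -1).  Removing
-- the first entry gives P (p+1) = T (P p) and N (p+1) + N p = T (N p) for the
-- linear convolution operator T u n = Σ_{k≥1} g_k u_{n-k}; with Pascal's rule
-- this yields P m n = Σ_p C(m,p) N p n, and swapping the order of summation
-- in Σ_m f_m P m n finishes the proof.
module Submission where

open import Defs
open import Level using (Level)
open import Data.Nat using (ℕ; zero; suc; _∸_; _<_; _≤_; _≥_; s≤s; z≤n)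
import Data.Nat as ℕ
open import Data.Nat.Properties using (≤-refl; ≤-trans; ≤-pred; <⇒≤; m∸n≤m; n≤1+n)
open import Data.Nat.Combinatorics using (_C_; k>n⇒nCk≡0; nCk+nC[k+1]≡[n+1]C[k+1])
open import Data.List using (List; []; _∷_; map; concatMap; applyUpTo; upTo; length; _++_)
open import Data.Product using (_×_; _,_)
open import Function using (_∘_)
open import Algebra.Bundles using (CommutativeRing)
import Relation.Binary.PropositionalEquality as ≡

module _ {c ℓ : Level} (R : CommutativeRing c ℓ) where
  open CommutativeRing R
  open InRing R renaming (_×_ to _·ℕ_)
  open import Relation.Binary.Reasoning.Setoid setoid
  open import Algebra.Properties.Ring ring using (-1*x≈-x)
  open import Algebra.Properties.CommutativeSemigroup +-commutativeSemigroup
    using (interchange; x∙yz≈y∙xz)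
  open import Algebra.Properties.CommutativeMonoid.Mult +-commutativeMonoid
    using (×-congʳ; ×-homo-+; ×-distrib-+)
  open import Algebra.Properties.Semiring.Mult semiring using (×-comm-*; ×-assoc-*)

  ×-zeroʳ : ∀ k → k ·ℕ 0# ≈ 0#
  ×-zeroʳ zero    = refl
  ×-zeroʳ (suc k) = trans (+-identityˡ _) (×-zeroʳ k)

  binomial-vanishes : ∀ {m i} → m < i → ∀ x → (m C i) ·ℕ x ≈ 0#
  binomial-vanishes m<i x = reflexive (≡.cong (_·ℕ x) (k>n⇒nCk≡0 m<i))

  sumBelow : ℕ → (ℕ → Carrier) → Carrier
  sumBelow zero    u = 0#
  sumBelow (suc n) u = u 0 + sumBelow n (u ∘ suc)

  sumBelow-cong : ∀ n {u v : ℕ → Carrier} → (∀ i → i < n → u i ≈ v i) →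
                  sumBelow n u ≈ sumBelow n v
  sumBelow-cong zero    u≈v = refl
  sumBelow-cong (suc n) u≈v =
    +-cong (u≈v 0 (s≤s z≤n)) (sumBelow-cong n (λ i i<n → u≈v (suc i) (s≤s i<n)))

  sumBelow-zero : ∀ n {u : ℕ → Carrier} → (∀ i → i < n → u i ≈ 0#) → sumBelow n u ≈ 0#
  sumBelow-zero zero    u≈0 = refl
  sumBelow-zero (suc n) u≈0 =
    trans (+-cong (u≈0 0 (s≤s z≤n)) (sumBelow-zero n (λ i i<n → u≈0 (suc i) (s≤s i<n))))
          (+-identityˡ 0#)

  sumBelow-extend : ∀ {m N} (u : ℕ → Carrier) → m ≤ N → (∀ i → m ≤ i → u i ≈ 0#) →
                    sumBelow m u ≈ sumBelow N u
  sumBelow-extend {N = N} u z≤n u≈0 = sym (sumBelow-zero N (λ i _ → u≈0 i z≤n))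
  sumBelow-extend u (s≤s m≤N) u≈0 =
    +-congˡ (sumBelow-extend (u ∘ suc) m≤N (λ i m≤i → u≈0 (suc i) (s≤s m≤i)))

  sumBelow-dropInit : ∀ {a N} (u : ℕ → Carrier) → a ≤ N → (∀ i → i < a → u i ≈ 0#) →
                      sumBelow (N ∸ a) (λ j → u (a ℕ.+ j)) ≈ sumBelow N u
  sumBelow-dropInit u z≤n u≈0 = refl
  sumBelow-dropInit {suc a} {suc N} u (s≤s a≤N) u≈0 = begin
    sumBelow (N ∸ a) (λ j → u (suc a ℕ.+ j))
      ≈⟨ sumBelow-dropInit (u ∘ suc) a≤N (λ i i<a → u≈0 (suc i) (s≤s i<a)) ⟩
    sumBelow N (u ∘ suc)                     ≈⟨ +-identityˡ _ ⟨
    0# + sumBelow N (u ∘ suc)                ≈⟨ +-congʳ (u≈0 0 (s≤s z≤n)) ⟨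
    sumBelow (suc N) u                       ∎

  sumBelow-+ : ∀ n (u v : ℕ → Carrier) →
               sumBelow n (λ i → u i + v i) ≈ sumBelow n u + sumBelow n v
  sumBelow-+ zero    u v = sym (+-identityˡ 0#)
  sumBelow-+ (suc n) u v =
    trans (+-congˡ (sumBelow-+ n (u ∘ suc) (v ∘ suc))) (interchange _ _ _ _)

  sumBelow-*ˡ : ∀ n a (u : ℕ → Carrier) → sumBelow n (λ i → a * u i) ≈ a * sumBelow n u
  sumBelow-*ˡ zero    a u = sym (zeroʳ a)
  sumBelow-*ˡ (suc n) a u = trans (+-congˡ (sumBelow-*ˡ n a (u ∘ suc))) (sym (distribˡ a _ _))

  sumBelow-*ʳ : ∀ n a (u : ℕ → Carrier) → sumBelow n (λ i → u i * a) ≈ sumBelow n u * a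
  sumBelow-*ʳ zero    a u = sym (zeroˡ a)
  sumBelow-*ʳ (suc n) a u = trans (+-congˡ (sumBelow-*ʳ n a (u ∘ suc))) (sym (distribʳ a _ _))

  sumBelow-×ˡ : ∀ n k (u : ℕ → Carrier) → sumBelow n (λ i → k ·ℕ u i) ≈ k ·ℕ sumBelow n u
  sumBelow-×ˡ zero    k u = sym (×-zeroʳ k)
  sumBelow-×ˡ (suc n) k u =
    trans (+-congˡ (sumBelow-×ˡ n k (u ∘ suc))) (sym (×-distrib-+ _ _ k))

  sumBelow-swap : ∀ n m (w : ℕ → ℕ → Carrier) →
                  sumBelow n (λ i → sumBelow m (w i)) ≈ sumBelow m (λ j → sumBelow n (λ i → w i j))
  sumBelow-swap zero    m w = sym (sumBelow-zero m (λ _ _ → refl))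
  sumBelow-swap (suc n) m w =
    trans (+-congˡ (sumBelow-swap n m (w ∘ suc)))
          (sym (sumBelow-+ m (w 0) (λ j → sumBelow n (λ i → w (suc i) j))))

  sumBelow-interchange-× : ∀ N M (f a : ℕ → Carrier) (c : ℕ → ℕ → ℕ) →
    sumBelow N (λ m → f m * sumBelow M (λ p → c m p ·ℕ a p))
      ≈ sumBelow M (λ p → sumBelow N (λ m → c m p ·ℕ f m) * a p)
  sumBelow-interchange-× N M f a c = begin
    sumBelow N (λ m → f m * sumBelow M (λ p → c m p ·ℕ a p))
      ≈⟨ sumBelow-cong N (λ m _ → sumBelow-*ˡ M (f m) (λ p → c m p ·ℕ a p)) ⟨
    sumBelow N (λ m → sumBelow M (λ p → f m * (c m p ·ℕ a p)))
      ≈⟨ sumBelow-swap N M _ ⟩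
    sumBelow M (λ p → sumBelow N (λ m → f m * (c m p ·ℕ a p)))
      ≈⟨ sumBelow-cong M (λ p _ → sumBelow-cong N (λ m _ →
           trans (×-comm-* (c m p) (f m) (a p)) (sym (×-assoc-* (c m p) (f m) (a p))))) ⟩
    sumBelow M (λ p → sumBelow N (λ m → (c m p ·ℕ f m) * a p))
      ≈⟨ sumBelow-cong M (λ p _ → sumBelow-*ʳ N (a p) (λ m → c m p ·ℕ f m)) ⟩
    sumBelow M (λ p → sumBelow N (λ m → c m p ·ℕ f m) * a p) ∎

  sumBelow-pascal : ∀ m (a : ℕ → Carrier) →
    sumBelow (suc (suc m)) (λ p → (suc m C p) ·ℕ a p)
      ≈ sumBelow (suc m) (λ p → (m C p) ·ℕ (a (suc p) + a p))
  sumBelow-pascal m a = begin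
    b 0 + sumBelow (suc m) (λ p → (suc m C suc p) ·ℕ a (suc p))
      ≈⟨ +-congˡ (sumBelow-cong (suc m) {v = λ p → (m C p) ·ℕ a (suc p) + b (suc p)}
                   (λ p _ → pascal p)) ⟩
    b 0 + sumBelow (suc m) (λ p → (m C p) ·ℕ a (suc p) + b (suc p))
      ≈⟨ +-congˡ (sumBelow-+ (suc m) (λ p → (m C p) ·ℕ a (suc p)) (b ∘ suc)) ⟩
    b 0 + (A + sumBelow (suc m) (b ∘ suc))
      ≈⟨ x∙yz≈y∙xz _ _ _ ⟩
    A + sumBelow (suc (suc m)) b
      ≈⟨ +-congˡ (sumBelow-extend b (n≤1+n (suc m)) (λ i m<i → binomial-vanishes m<i (a i))) ⟨
    A + sumBelow (suc m) b
      ≈⟨ sumBelow-+ (suc m) (λ p → (m C p) ·ℕ a (suc p)) b ⟨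
    sumBelow (suc m) (λ p → (m C p) ·ℕ a (suc p) + b p)
      ≈⟨ sumBelow-cong (suc m) {v = λ p → (m C p) ·ℕ a (suc p) + b p}
           (λ p _ → ×-distrib-+ _ _ (m C p)) ⟨
    sumBelow (suc m) (λ p → (m C p) ·ℕ (a (suc p) + a p)) ∎
    where
      b : ℕ → Carrier
      b p = (m C p) ·ℕ a p
      A : Carrier
      A = sumBelow (suc m) (λ p → (m C p) ·ℕ a (suc p))
      pascal : ∀ p → (suc m C suc p) ·ℕ a (suc p) ≈ (m C p) ·ℕ a (suc p) + b (suc p)
      pascal p = trans (reflexive (≡.cong (_·ℕ a (suc p)) (≡.sym (nCk+nC[k+1]≡[n+1]C[k+1] m p))))
                       (×-homo-+ _ (m C p) (m C suc p))

  Σ-*ˡ : ∀ {A : Set} (xs : List A) a h → Σ xs (λ x → a * h x) ≈ a * Σ xs h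
  Σ-*ˡ []       a h = sym (zeroʳ a)
  Σ-*ˡ (x ∷ xs) a h = trans (+-congˡ (Σ-*ˡ xs a h)) (sym (distribˡ a _ _))

  Σ-++ : ∀ {A : Set} (xs ys : List A) h → Σ (xs ++ ys) h ≈ Σ xs h + Σ ys h
  Σ-++ []       ys h = sym (+-identityˡ _)
  Σ-++ (x ∷ xs) ys h = trans (+-congˡ (Σ-++ xs ys h)) (sym (+-assoc _ _ _))

  Σ-map : ∀ {A B : Set} (φ : A → B) (xs : List A) h → Σ (map φ xs) h ≈ Σ xs (h ∘ φ)
  Σ-map φ []       h = refl
  Σ-map φ (x ∷ xs) h = +-congˡ (Σ-map φ xs h)

  Σ-concatMap : ∀ {A B : Set} (F : A → List B) (xs : List A) h →
                Σ (concatMap F xs) h ≈ Σ xs (λ x → Σ (F x) h)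
  Σ-concatMap F []       h = refl
  Σ-concatMap F (x ∷ xs) h = trans (Σ-++ (F x) (concatMap F xs) h) (+-congˡ (Σ-concatMap F xs h))

  Σ-applyUpTo : ∀ {A : Set} (u : ℕ → A) m h → Σ (applyUpTo u m) h ≈ sumBelow m (h ∘ u)
  Σ-applyUpTo u zero    h = refl
  Σ-applyUpTo u (suc m) h = +-congˡ (Σ-applyUpTo (u ∘ suc) m h)

  Σ-range : ∀ {a} b (u : ℕ → Carrier) → a ≤ suc b → (∀ i → i < a → u i ≈ 0#) →
            Σ (range a b) u ≈ sumBelow (suc b) u
  Σ-range {a} b u a≤ u≈0 =
    trans (Σ-applyUpTo (a ℕ.+_) (suc b ∸ a) u) (sumBelow-dropInit u a≤ u≈0)

  Σ-range-from1 : ∀ b (u : ℕ → Carrier) → u 0 ≈ 0# → Σ (range 1 b) u ≈ sumBelow (suc b) u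
  Σ-range-from1 b u u0≈0 = Σ-range b u (s≤s z≤n) (λ { 0 _ → u0≈0 ; (suc i) (s≤s ()) })

  Σ-posTuples-suc : ∀ p n (h : List ℕ → Carrier) →
    Σ (posTuples (suc p) n) h ≈ sumBelow n (λ i → Σ (posTuples p (n ∸ suc i)) (h ∘ (suc i ∷_)))
  Σ-posTuples-suc p n h =
    trans (Σ-concatMap (λ k → map (k ∷_) (posTuples p (n ∸ k))) (range 1 n) h)
          (trans (Σ-applyUpTo suc n _)
                 (sumBelow-cong n (λ i _ → Σ-map (suc i ∷_) (posTuples p (n ∸ suc i)) h)))

  Σ-natTuples-suc : ∀ p n (h : List ℕ → Carrier) →
    Σ (natTuples (suc p) n) h ≈ sumBelow (suc n) (λ i → Σ (natTuples p (n ∸ i)) (h ∘ (i ∷_)))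
  Σ-natTuples-suc p n h =
    trans (Σ-concatMap (λ k → map (k ∷_) (natTuples p (n ∸ k))) (range 0 n) h)
          (trans (Σ-applyUpTo (λ i → i) (suc n) _)
                 (sumBelow-cong (suc n) (λ i _ → Σ-map (i ∷_) (natTuples p (n ∸ i)) h)))

  Σ-posTuples-length : ∀ p n (φ : ℕ → List ℕ → Carrier) →
    Σ (posTuples p n) (λ π → φ (length π) π) ≈ Σ (posTuples p n) (φ p)
  Σ-posTuples-length zero    zero    φ = refl
  Σ-posTuples-length zero    (suc n) φ = refl
  Σ-posTuples-length (suc p) n       φ = begin
    Σ (posTuples (suc p) n) (λ π → φ (length π) π)
      ≈⟨ Σ-posTuples-suc p n _ ⟩
    sumBelow n (λ i → Σ (posTuples p (n ∸ suc i)) (λ π → φ (suc (length π)) (suc i ∷ π)))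
      ≈⟨ sumBelow-cong n (λ i _ →
           Σ-posTuples-length p (n ∸ suc i) (λ q → φ (suc q) ∘ (suc i ∷_))) ⟩
    sumBelow n (λ i → Σ (posTuples p (n ∸ suc i)) (φ (suc p) ∘ (suc i ∷_)))
      ≈⟨ Σ-posTuples-suc p n _ ⟨
    Σ (posTuples (suc p) n) (φ (suc p)) ∎

  Σ-compsF : ∀ F n M → n ≤ F → n ≤ M → (h : List ℕ → Carrier) →
             Σ (compsF F n) h ≈ sumBelow (suc M) (λ p → Σ (posTuples p n) h)
  Σ-compsF F zero M _ _ h =
    sym (trans (+-congˡ (sumBelow-zero M (λ _ _ → refl))) (+-identityʳ _))
  Σ-compsF (suc F) (suc n) (suc M) (s≤s n≤F) (s≤s n≤M) h = begin
    Σ (compsF (suc F) (suc n)) h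
      ≈⟨ Σ-concatMap (λ k → map (suc k ∷_) (compsF F (n ∸ k))) (upTo (suc n)) h ⟩
    Σ (upTo (suc n)) (λ k → Σ (map (suc k ∷_) (compsF F (n ∸ k))) h)
      ≈⟨ Σ-applyUpTo (λ k → k) (suc n) _ ⟩
    sumBelow (suc n) (λ k → Σ (map (suc k ∷_) (compsF F (n ∸ k))) h)
      ≈⟨ sumBelow-cong (suc n) (λ k _ → Σ-map (suc k ∷_) (compsF F (n ∸ k)) h) ⟩
    sumBelow (suc n) (λ k → Σ (compsF F (n ∸ k)) (h ∘ (suc k ∷_)))
      ≈⟨ sumBelow-cong (suc n) (λ k _ → Σ-compsF F (n ∸ k) M
           (≤-trans (m∸n≤m n k) n≤F) (≤-trans (m∸n≤m n k) n≤M) (h ∘ (suc k ∷_))) ⟩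
    sumBelow (suc n) (λ k → sumBelow (suc M) (λ p → Σ (posTuples p (n ∸ k)) (h ∘ (suc k ∷_))))
      ≈⟨ sumBelow-swap (suc n) (suc M) (λ k p → Σ (posTuples p (n ∸ k)) (h ∘ (suc k ∷_))) ⟩
    sumBelow (suc M) (λ p → sumBelow (suc n) (λ k → Σ (posTuples p (n ∸ k)) (h ∘ (suc k ∷_))))
      ≈⟨ sumBelow-cong (suc M) (λ p _ → Σ-posTuples-suc p (suc n) h) ⟨
    sumBelow (suc M) (λ p → Σ (posTuples (suc p) (suc n)) h)
      ≈⟨ +-identityˡ _ ⟨
    sumBelow (suc (suc M)) (λ p → Σ (posTuples p (suc n)) h) ∎

  Σ-compositions-byParts : (f : ℕ → Carrier) (G : List ℕ → Carrier) (n : ℕ) →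
    Σ (compositions (suc n)) (λ π → f (length π) * G π)
      ≈ Σ (range 1 (suc n)) (λ p → f p * Σ (posTuples p (suc n)) G)
  Σ-compositions-byParts f G n = begin
    Σ (compositions (suc n)) (λ π → f (length π) * G π)
      ≈⟨ Σ-compsF (suc n) (suc n) (suc n) ≤-refl ≤-refl _ ⟩
    sumBelow (suc (suc n)) (λ p → Σ (posTuples p (suc n)) (λ π → f (length π) * G π))
      ≈⟨ sumBelow-cong (suc (suc n)) (λ p _ →
           trans (Σ-posTuples-length p (suc n) (λ q π → f q * G π))
                 (Σ-*ˡ (posTuples p (suc n)) (f p) G)) ⟩
    sumBelow (suc (suc n)) (λ p → f p * Σ (posTuples p (suc n)) G)
      ≈⟨ Σ-range-from1 (suc n) (λ p → f p * Σ (posTuples p (suc n)) G) (zeroʳ (f 0)) ⟨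
    Σ (range 1 (suc n)) (λ p → f p * Σ (posTuples p (suc n)) G) ∎

  module WithG₀ (g : ℕ → Carrier) where

    posSum : ℕ → ℕ → Carrier
    posSum p n = Σ (posTuples p n) (gProd (withG₀ g))

    natSum : ℕ → ℕ → Carrier
    natSum p n = Σ (natTuples p n) (gProd (withG₀ g))

    convolve : ℕ → (ℕ → Carrier) → Carrier
    convolve n u = sumBelow n (λ i → g (suc i) * u (n ∸ suc i))

    convolve-cong : ∀ n {u v : ℕ → Carrier} → (∀ k → u k ≈ v k) →
                    convolve n u ≈ convolve n v
    convolve-cong n u≈v = sumBelow-cong n (λ i _ → *-congˡ (u≈v _))

    convolve-linear : ∀ n M (c : ℕ → ℕ) (w : ℕ → ℕ → Carrier) →
      convolve n (λ k → sumBelow M (λ p → c p ·ℕ w p k))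
        ≈ sumBelow M (λ p → c p ·ℕ convolve n (w p))
    convolve-linear n M c w = begin
      sumBelow n (λ i → g (suc i) * sumBelow M (λ p → c p ·ℕ w p (n ∸ suc i)))
        ≈⟨ sumBelow-cong n (λ i _ → sumBelow-*ˡ M (g (suc i)) _) ⟨
      sumBelow n (λ i → sumBelow M (λ p → g (suc i) * (c p ·ℕ w p (n ∸ suc i))))
        ≈⟨ sumBelow-swap n M _ ⟩
      sumBelow M (λ p → sumBelow n (λ i → g (suc i) * (c p ·ℕ w p (n ∸ suc i))))
        ≈⟨ sumBelow-cong M (λ p _ → sumBelow-cong n (λ i _ → ×-comm-* (c p) _ _)) ⟩
      sumBelow M (λ p → sumBelow n (λ i → c p ·ℕ (g (suc i) * w p (n ∸ suc i))))
        ≈⟨ sumBelow-cong M (λ p _ → sumBelow-×ˡ n (c p) _) ⟩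
      sumBelow M (λ p → c p ·ℕ convolve n (w p)) ∎

    posSum-suc : ∀ p n → posSum (suc p) n ≈ convolve n (posSum p)
    posSum-suc p n = trans (Σ-posTuples-suc p n _)
      (sumBelow-cong n (λ i _ → Σ-*ˡ (posTuples p (n ∸ suc i)) (g (suc i)) _))

    -- A leading zero contributes the factor g₀ = -1.
    natSum-suc : ∀ p n → natSum (suc p) n + natSum p n ≈ convolve n (natSum p)
    natSum-suc p n = begin
      natSum (suc p) n + natSum p n
        ≈⟨ +-congʳ (Σ-natTuples-suc p n _) ⟩
      (Σ (natTuples p n) (λ π → - 1# * gProd (withG₀ g) π)
        + sumBelow n (λ i → Σ (natTuples p (n ∸ suc i)) (λ π → g (suc i) * gProd (withG₀ g) π)))
        + natSum p n
        ≈⟨ +-congʳ (+-cong (trans (Σ-*ˡ (natTuples p n) (- 1#) _) (-1*x≈-x _))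
             (sumBelow-cong n (λ i _ → Σ-*ˡ (natTuples p (n ∸ suc i)) (g (suc i)) _))) ⟩
      (- natSum p n + convolve n (natSum p)) + natSum p n
        ≈⟨ +-congʳ (+-comm _ _) ⟩
      (convolve n (natSum p) + - natSum p n) + natSum p n
        ≈⟨ +-assoc _ _ _ ⟩
      convolve n (natSum p) + (- natSum p n + natSum p n)
        ≈⟨ +-congˡ (-‿inverseˡ _) ⟩
      convolve n (natSum p) + 0#
        ≈⟨ +-identityʳ _ ⟩
      convolve n (natSum p) ∎

    natSum-zero : ∀ n → natSum 0 n ≈ posSum 0 n
    natSum-zero zero    = refl
    natSum-zero (suc n) = refl

    posSum-binomial : ∀ m n → posSum m n ≈ sumBelow (suc m) (λ p → (m C p) ·ℕ natSum p n)
    posSum-binomial zero    n = sym (trans (+-identityʳ _) (trans (+-identityʳ _) (natSum-zero n)))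
    posSum-binomial (suc m) n = begin
      posSum (suc m) n
        ≈⟨ posSum-suc m n ⟩
      convolve n (posSum m)
        ≈⟨ convolve-cong n (posSum-binomial m) ⟩
      convolve n (λ k → sumBelow (suc m) (λ p → (m C p) ·ℕ natSum p k))
        ≈⟨ convolve-linear n (suc m) (m C_) natSum ⟩
      sumBelow (suc m) (λ p → (m C p) ·ℕ convolve n (natSum p))
        ≈⟨ sumBelow-cong (suc m) (λ p _ → ×-congʳ (m C p) (natSum-suc p n)) ⟨
      sumBelow (suc m) (λ p → (m C p) ·ℕ (natSum (suc p) n + natSum p n))
        ≈⟨ sumBelow-pascal m (λ p → natSum p n) ⟨
      sumBelow (suc (suc m)) (λ p → (suc m C p) ·ℕ natSum p n) ∎

    posSum-binomial-upTo : ∀ {m N} n → m ≤ N →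
      posSum m n ≈ sumBelow (suc N) (λ p → (m C p) ·ℕ natSum p n)
    posSum-binomial-upTo {m} n m≤N = trans (posSum-binomial m n)
      (sumBelow-extend (λ p → (m C p) ·ℕ natSum p n) (s≤s m≤N)
                       (λ i m<i → binomial-vanishes m<i _))

    Σ-posSum-by-natSum : (f : ℕ → Carrier) (n : ℕ) →
      Σ (range 1 (suc n)) (λ p → f p * posSum p (suc n))
        ≈ Σ (range 1 (suc n)) (λ p → Σ (range p (suc n)) (λ m → (m C p) ·ℕ f m) * natSum p (suc n))
    Σ-posSum-by-natSum f n = begin
      Σ (range 1 N) (λ p → f p * posSum p N)
        ≈⟨ Σ-range-from1 N (λ m → f m * posSum m N) (zeroʳ (f 0)) ⟩
      sumBelow (suc N) (λ m → f m * posSum m N)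
        ≈⟨ sumBelow-cong (suc N) {u = λ m → f m * posSum m N}
             (λ m m<1+N → *-congˡ (posSum-binomial-upTo N (≤-pred m<1+N))) ⟩
      sumBelow (suc N) (λ m → f m * sumBelow (suc N) (λ p → (m C p) ·ℕ natSum p N))
        ≈⟨ sumBelow-interchange-× (suc N) (suc N) f (λ p → natSum p N) _C_ ⟩
      sumBelow (suc N) (λ p → sumBelow (suc N) (λ m → (m C p) ·ℕ f m) * natSum p N)
        ≈⟨ sumBelow-cong (suc N) {u = term} (λ p p<1+N → *-congʳ (weight≈ p (<⇒≤ p<1+N))) ⟨
      sumBelow (suc N) term
        ≈⟨ Σ-range-from1 N term (zeroʳ _) ⟨
      Σ (range 1 N) term ∎
      where
        N : ℕ
        N = suc n
        weight : ℕ → Carrier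
        weight p = Σ (range p N) (λ m → (m C p) ·ℕ f m)
        term : ℕ → Carrier
        term p = weight p * natSum p N
        weight≈ : ∀ p → p ≤ suc N → weight p ≈ sumBelow (suc N) (λ m → (m C p) ·ℕ f m)
        weight≈ p p≤ = Σ-range N (λ m → (m C p) ·ℕ f m) p≤ (λ m m<p → binomial-vanishes m<p (f m))

theorem12 : {c ℓ : Level} (R : CommutativeRing c ℓ) →
    let open CommutativeRing R renaming (_≈_ to _≈R_) in
    let open InRing R renaming (_×_ to _·ℕ_) in
    (f g : ℕ → Carrier) → (n : ℕ) → n ≥ 1 →
      (Σ (compositions n) (λ π → f (length π) * gProd (withG₀ g) π)
        ≈R Σ (range 1 n) (λ p → f p * Σ (posTuples p n) (gProd (withG₀ g))))
      × (Σ (range 1 n) (λ p → f p * Σ (posTuples p n) (gProd (withG₀ g)))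
        ≈R Σ (range 1 n) (λ p → Σ (range p n) (λ m → (m C p) ·ℕ f m)
                                  * Σ (natTuples p n) (gProd (withG₀ g))))
theorem12 R f g (suc n) _ =
  Σ-compositions-byParts R f (InRing.gProd R (InRing.withG₀ R g)) n ,
  WithG₀.Σ-posSum-by-natSum R g f n
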